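{- Let $X$ be a set and $K\subseteq\wp(X\times X)$ a relational KAT on $X$ whose set of tests is $\mathrm{Test}(K)=\wp(\{(x,x)\mid x\in X\})$, equipped with a backward-diamond operator $\langle\cdot]\cdot$ making it a bdKAT. Then for all $a,b\in K$: $\langle a]=\langle b]$ (as functions $\mathrm{Test}(K)\to\mathrm{Test}(K)$) if and only if $a=b$.
   Context: A relational KAT on $X$ is a set $K\subseteq\wp(X\times X)$ of binary relations closed under the operations, with tests $\mathrm{Test}(K)$ being subsets of the identity relation, where $+$ is union, multiplication is relational composition ($(x,z)\in ab$ iff $\exists y$ with $(x,y)\in a$, $(y,z)\in b$), $0=\emptyset$, $1=\{(x,x)\mid x\in X\}$, $a^*$ is the reflexive-transitive closure, and test complement is complement relative to $1$; the order is inclusion. A backward-diamond operator is a map $\langle\cdot]\cdot:K\to(\mathrm{Test}(K)\to\mathrm{Test}(K))$ such that for all $a,b\in K$ and $p,q\in\mathrm{Test}(K)$: $\langle a]p\le q\iff pa\le aq$, and $\langle ab]p=\langle b](\langle a]p)$. -}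

module Defs where

open import Level using (0ℓ)
open import Data.Empty using (⊥)
open import Data.Sum using (_⊎_)
open import Data.Product using (Σ; ∃; _×_; _,_)
open import Relation.Nullary using (¬_)
open import Relation.Binary.PropositionalEquality using (_≡_)
open import Relation.Binary.Construct.Closure.ReflexiveTransitive using (Star)
open import Function.Bundles using (_⇔_)

BRel : Set → Set₁
BRel X = X → X → Set

module _ {X : Set} where

  _⊑_ : BRel X → BRel X → Set
  a ⊑ b = ∀ x y → a x y → b x y

  _≐_ : BRel X → BRel X → Set
  a ≐ b = (a ⊑ b) × (b ⊑ a)

  𝟘 : BRel X
  𝟘 _ _ = ⊥

  𝟙 : BRel X
  𝟙 x y = x ≡ y

  _∪_ : BRel X → BRel X → BRel X
  (a ∪ b) x y = a x y ⊎ b x y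

  _⨾_ : BRel X → BRel X → BRel X
  (a ⨾ b) x z = ∃ λ y → a x y × b y z

  _⋆ : BRel X → BRel X
  a ⋆ = Star a

  IsTest : BRel X → Set
  IsTest p = p ⊑ 𝟙

  ∁ₜ : BRel X → BRel X
  ∁ₜ p x y = (x ≡ y) × ¬ p x y

record RelKAT (X : Set) : Set₁ where
  field
    K      : BRel X → Set
    K-𝟘    : K 𝟘
    K-𝟙    : K 𝟙
    K-∪    : ∀ {a b} → K a → K b → K (a ∪ b)
    K-⨾    : ∀ {a b} → K a → K b → K (a ⨾ b)
    K-⋆    : ∀ {a} → K a → K (a ⋆)
    K-∁    : ∀ {p} → K p → IsTest p → K (∁ₜ p)
    K-test : ∀ p → IsTest p → K p

record BDiamond {X : Set} (R : RelKAT X) : Set₁ where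
  open RelKAT R
  -- dia a ka p tp  stands for  ⟨a]p
  field
    dia      : (a : BRel X) → K a → (p : BRel X) → IsTest p → BRel X
    dia-test  : ∀ a (ka : K a) p (tp : IsTest p) → IsTest (dia a ka p tp)
    dia-galois : ∀ a (ka : K a) p (tp : IsTest p) q (tq : IsTest q) →
                (dia a ka p tp ⊑ q) ⇔ ((p ⨾ a) ⊑ (a ⨾ q))
    dia-comp  : ∀ a (ka : K a) b (kb : K b) p (tp : IsTest p) →
                dia (a ⨾ b) (K-⨾ ka kb) p tp
                  ≐ dia b kb (dia a ka p tp) (dia-test a ka p tp)

-- The Galois connection ⟨a]p ≤ q ⇔ pa ≤ aq determines ⟨a]p uniquely: it must be the
-- codomain of pa, the test {(y,y) | ∃ x. p x x ∧ a x y}. Hence ⟨a] depends only on a.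
-- Conversely a is recovered from ⟨a] by probing with singleton tests {(x,x)}: (x,y) ∈ a
-- iff (y,y) ∈ ⟨a]{(x,x)}.
module Submission where

open import Defs
open import Function.Base using (_∘_)
open import Function.Bundles using (_⇔_; mk⇔; Equivalence)
open import Data.Product using (∃; _×_; _,_; proj₁; proj₂; swap)
open import Relation.Binary.PropositionalEquality using (_≡_; refl; sym; trans; subst)

module _ {X : Set} where

  ⊑-refl : {r : BRel X} → r ⊑ r
  ⊑-refl _ _ h = h

  ⊑-trans : {r s t : BRel X} → r ⊑ s → s ⊑ t → r ⊑ t
  ⊑-trans r⊑s s⊑t x y = s⊑t x y ∘ r⊑s x y

  ≐-sym : {r s : BRel X} → r ≐ s → s ≐ r
  ≐-sym = swap

  ≐-trans : {r s t : BRel X} → r ≐ s → s ≐ t → r ≐ t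
  ≐-trans (r⊑s , s⊑r) (s⊑t , t⊑s) = ⊑-trans r⊑s s⊑t , ⊑-trans t⊑s s⊑r

  cod : BRel X → BRel X
  cod r y y′ = (y ≡ y′) × ∃ λ x → r x y

  cod-isTest : (r : BRel X) → IsTest (cod r)
  cod-isTest r _ _ = proj₁

  cod-mono : {r s : BRel X} → r ⊑ s → cod r ⊑ cod s
  cod-mono r⊑s y y′ (y≡y′ , x , rxy) = y≡y′ , x , r⊑s x y rxy

  cod-cong : {r s : BRel X} → r ≐ s → cod r ≐ cod s
  cod-cong (r⊑s , s⊑r) = cod-mono r⊑s , cod-mono s⊑r

  ⨾-monoʳ : (p : BRel X) {a b : BRel X} → a ⊑ b → (p ⨾ a) ⊑ (p ⨾ b)
  ⨾-monoʳ p a⊑b x z (y , pxy , ayz) = y , pxy , a⊑b y z ayz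

  ⨾-congʳ : (p : BRel X) {a b : BRel X} → a ≐ b → (p ⨾ a) ≐ (p ⨾ b)
  ⨾-congʳ p (a⊑b , b⊑a) = ⨾-monoʳ p a⊑b , ⨾-monoʳ p b⊑a

  test⨾-⊑-cod⨾ : {p : BRel X} → IsTest p → (a : BRel X) → (p ⨾ a) ⊑ (a ⨾ cod (p ⨾ a))
  test⨾-⊑-cod⨾ tp a x z (w , pxw , awz) =
    z , subst (λ t → a t z) (sym (tp x w pxw)) awz , refl , x , w , pxw , awz

  singleton : X → BRel X
  singleton x u v = (u ≡ x) × (v ≡ x)

  singleton-isTest : (x : X) → IsTest (singleton x)
  singleton-isTest x u v (u≡x , v≡x) = trans u≡x (sym v≡x)

  ∈⇒∈cod-singleton⨾ : (a : BRel X) {x y : X} → a x y → cod (singleton x ⨾ a) y y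
  ∈⇒∈cod-singleton⨾ a {x} axy = refl , x , x , (refl , refl) , axy

  ∈cod-singleton⨾⇒∈ : (a : BRel X) {x y : X} → cod (singleton x ⨾ a) y y → a x y
  ∈cod-singleton⨾⇒∈ a {y = y} (_ , _ , x′ , (_ , x′≡x) , ax′y) = subst (λ t → a t y) x′≡x ax′y

module _ {X : Set} {R : RelKAT X} (D : BDiamond R) where
  open RelKAT R
  open BDiamond D

  test⨾⊑⨾dia : ∀ a (ka : K a) p (tp : IsTest p) → (p ⨾ a) ⊑ (a ⨾ dia a ka p tp)
  test⨾⊑⨾dia a ka p tp =
    Equivalence.to (dia-galois a ka p tp _ (dia-test a ka p tp)) ⊑-refl

  dia⊑cod : ∀ a (ka : K a) p (tp : IsTest p) → dia a ka p tp ⊑ cod (p ⨾ a)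
  dia⊑cod a ka p tp =
    Equivalence.from (dia-galois a ka p tp _ (cod-isTest (p ⨾ a))) (test⨾-⊑-cod⨾ tp a)

  -- The unit pa ≤ a⟨a]p yields some m with (m, y) ∈ ⟨a]p, and m = y as ⟨a]p is a test.
  cod⊑dia : ∀ a (ka : K a) p (tp : IsTest p) → cod (p ⨾ a) ⊑ dia a ka p tp
  cod⊑dia a ka p tp y y′ (y≡y′ , x , pxa) with test⨾⊑⨾dia a ka p tp x y pxa
  ... | m , _ , dia-my =
    subst (dia a ka p tp y) y≡y′ (subst (λ t → dia a ka p tp t y) (dia-test a ka p tp m y dia-my) dia-my)

  dia≐cod : ∀ a (ka : K a) p (tp : IsTest p) → dia a ka p tp ≐ cod (p ⨾ a)
  dia≐cod a ka p tp = dia⊑cod a ka p tp , cod⊑dia a ka p tp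

  ⊑-of-dia⊑ : ∀ a (ka : K a) b (kb : K b) →
    (∀ p (tp : IsTest p) → dia a ka p tp ⊑ dia b kb p tp) → a ⊑ b
  ⊑-of-dia⊑ a ka b kb dia-a⊑dia-b x y axy =
    ∈cod-singleton⨾⇒∈ b (cod-b y y (dia-a⊑dia-b p tp y y (cod-a y y (∈⇒∈cod-singleton⨾ a axy))))
    where
    p : BRel X
    p = singleton x
    tp : IsTest p
    tp = singleton-isTest x
    cod-a : cod (p ⨾ a) ⊑ dia a ka p tp
    cod-a = cod⊑dia a ka p tp
    cod-b : dia b kb p tp ⊑ cod (p ⨾ b)
    cod-b = dia⊑cod b kb p tp

  dia-cong : ∀ a (ka : K a) b (kb : K b) → a ≐ b →
    ∀ p (tp : IsTest p) → dia a ka p tp ≐ dia b kb p tp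
  dia-cong a ka b kb a≐b p tp =
    ≐-trans (dia≐cod a ka p tp)
      (≐-trans (cod-cong (⨾-congʳ p a≐b)) (≐-sym (dia≐cod b kb p tp)))

proposition2 : (X : Set) (R : RelKAT X) (D : BDiamond R) →
    ∀ a (ka : RelKAT.K R a) b (kb : RelKAT.K R b) →
      (∀ p (tp : IsTest p) →
         BDiamond.dia D a ka p tp ≐ BDiamond.dia D b kb p tp)
      ⇔ (a ≐ b)
proposition2 X R D a ka b kb = mk⇔
  (λ dia-a≐dia-b →
     ⊑-of-dia⊑ D a ka b kb (λ p tp → proj₁ (dia-a≐dia-b p tp)) ,
     ⊑-of-dia⊑ D b kb a ka (λ p tp → proj₂ (dia-a≐dia-b p tp)))
  (dia-cong D a ka b kb)
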